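{- Let $(G_1,G_2,S)$ be a constrained alignment instance with $m_1,m_2$ arbitrary positive integers, and let $\Delta_1,\Delta_2$ be the maximum degrees of $G_1,G_2$. Then every vertex of the conflict graph $\mathcal{C}$ has degree at most $$2\Delta_1m_1^2+2\Delta_2m_2^2-2\Delta_1m_1-2\Delta_2m_2-m_1^2-m_2^2+2m_1+2m_2-2.$$
   Context: Let $G_1=(V_1,E_1)$ and $G_2=(V_2,E_2)$ be finite simple undirected graphs with $V_1\cap V_2=\emptyset$, and let $S$ be a bipartite graph with parts $V_1,V_2$ in which every vertex of $V_1$ has degree at most $m_1$ and every vertex of $V_2$ has degree at most $m_2$; edges of $S$ are similarity edges. A $c_4$ is a 4-cycle $a-b-c-d-a$ in $G_1\cup G_2\cup S$ with $a,b\in V_1$, $c,d\in V_2$, $ab\in E_1$, $cd\in E_2$, $ad,bc\in E(S)$, regarded as a subgraph. Two distinct $c_4$s conflict if their similarity edges cannot all belong to a common matching of $S$. The conflict graph $\mathcal{C}$ has one vertex per $c_4$ and an edge between each pair of conflicting $c_4$s. -}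

module Defs where

open import Data.Nat using (ℕ; zero; suc; _+_; _*_; _≤_; _<_; _⊔_)
open import Data.Bool using (Bool; true; false; if_then_else_; _∧_; _∨_; not; _xor_)
open import Data.Fin using (Fin; toℕ; _≟_)
open import Data.List using (List; []; _∷_; _++_; map; foldr; allFin)
open import Data.Nat.ListAction using (sum)
open import Data.Bool.ListAction using (any)
open import Data.Product using (_×_; _,_)
open import Relation.Nullary.Decidable using (⌊_⌋)
open import Relation.Binary.PropositionalEquality using (_≡_)
open import Data.Integer as ℤ using (ℤ; +_)

record SimpleGraph (n : ℕ) : Set where
  field
    adj   : Fin n → Fin n → Bool
    sym   : ∀ u v → adj u v ≡ adj v u
    irrefl : ∀ u → adj u u ≡ false
open SimpleGraph public

Bipartite : ℕ → ℕ → Set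
Bipartite n₁ n₂ = Fin n₁ → Fin n₂ → Bool

total : ∀ {n} → (Fin n → ℕ) → ℕ
total {n} f = sum (map f (allFin n))

count : ∀ {n} → (Fin n → Bool) → ℕ
count p = total (λ x → if p x then 1 else 0)

degree : ∀ {n} → SimpleGraph n → Fin n → ℕ
degree G u = count (adj G u)

maxDegree : ∀ {n} → SimpleGraph n → ℕ
maxDegree {n} G = foldr _⊔_ 0 (map (degree G) (allFin n))

degS₁ : ∀ {n₁ n₂} → Bipartite n₁ n₂ → Fin n₁ → ℕ
degS₁ S u = count (S u)

degS₂ : ∀ {n₁ n₂} → Bipartite n₁ n₂ → Fin n₂ → ℕ
degS₂ S v = count (λ u → S u v)

_==_ : ∀ {n} → Fin n → Fin n → Bool
x == y = ⌊ x ≟ y ⌋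

_<ᵇ_ : ∀ {n} → Fin n → Fin n → Bool
x <ᵇ y = ⌊ toℕ x Data.Nat.<? toℕ y ⌋

Quad : ℕ → ℕ → Set
Quad n₁ n₂ = Fin n₁ × Fin n₁ × Fin n₂ × Fin n₂

isC4 : ∀ {n₁ n₂} → SimpleGraph n₁ → SimpleGraph n₂ → Bipartite n₁ n₂ → Quad n₁ n₂ → Bool
isC4 G₁ G₂ S (a , b , c , d) = adj G₁ a b ∧ adj G₂ c d ∧ S a d ∧ S b c

-- A c4 regarded as a subgraph: (a,b,c,d) and (b,a,d,c) give the same
-- subgraph and no other tuple does; we take the canonical representative
-- with a < b.  So the vertices of the conflict graph are exactly the
-- quads with isC4 and a < b.
isC4vertex : ∀ {n₁ n₂} → SimpleGraph n₁ → SimpleGraph n₂ → Bipartite n₁ n₂ → Quad n₁ n₂ → Bool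
isC4vertex G₁ G₂ S q@(a , b , c , d) = isC4 G₁ G₂ S q ∧ (a <ᵇ b)

SimEdge : ℕ → ℕ → Set
SimEdge n₁ n₂ = Fin n₁ × Fin n₂

simEdges : ∀ {n₁ n₂} → Quad n₁ n₂ → List (SimEdge n₁ n₂)
simEdges (a , b , c , d) = (a , d) ∷ (b , c) ∷ []

-- two edges of S are distinct and share an endpoint
clash : ∀ {n₁ n₂} → SimEdge n₁ n₂ → SimEdge n₁ n₂ → Bool
clash (u , v) (u' , v') = (u == u') xor (v == v')

notMatching : ∀ {n₁ n₂} → List (SimEdge n₁ n₂) → Bool
notMatching es = any (λ e → any (clash e) es) es

conflict : ∀ {n₁ n₂} → Quad n₁ n₂ → Quad n₁ n₂ → Bool
conflict x y = notMatching (simEdges x ++ simEdges y)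

quadEq : ∀ {n₁ n₂} → Quad n₁ n₂ → Quad n₁ n₂ → Bool
quadEq (a , b , c , d) (a' , b' , c' , d') = (a == a') ∧ (b == b') ∧ (c == c') ∧ (d == d')

conflictDegree : ∀ {n₁ n₂} → SimpleGraph n₁ → SimpleGraph n₂ → Bipartite n₁ n₂ → Quad n₁ n₂ → ℕ
conflictDegree G₁ G₂ S x =
  total (λ a → total (λ b → total (λ c → count (λ d →
    let y = (a , b , c , d) in
    isC4vertex G₁ G₂ S y ∧ not (quadEq x y) ∧ conflict x y))))

bound : ℕ → ℕ → ℕ → ℕ → ℤ
bound Δ₁ Δ₂ m₁ m₂ =
  (+ (2 * Δ₁ * m₁ * m₁) ℤ.+ + (2 * Δ₂ * m₂ * m₂) ℤ.+ + (2 * m₁) ℤ.+ + (2 * m₂))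
  ℤ.- (+ (2 * Δ₁ * m₁) ℤ.+ + (2 * Δ₂ * m₂) ℤ.+ + (m₁ * m₁) ℤ.+ + (m₂ * m₂) ℤ.+ + 2)

module Submission where

-- A c4 y conflicts with x = (a, b, c, d) exactly when a similarity edge of y shares
-- exactly one endpoint with ad or bc, since the two similarity edges of one c4 are
-- disjoint. Sort the conflicting y by that shared endpoint. If it is a or b ∈ V₁, then y
-- is fixed by a G₁-neighbour w of it, an S-neighbour of w and a second S-neighbour of
-- the shared vertex: at most Δ₁m₁(m₁ − 1) choices. If it is d or c ∈ V₂, then y is fixed
-- by a second S-neighbour of the shared vertex, a G₂-neighbour z of it and an S-neighbour
-- of z: at most (m₂ − 1)Δ₂m₂ choices. Counting through b only the y not already counted
-- through a saves (m₁ − 1)² of them, and likewise for c and d, so side i contributes at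
-- most 2Δᵢmᵢ(mᵢ − 1) − (mᵢ − 1)²; the two contributions add up to the stated bound.

open import Defs hiding (sym)
open import Data.Nat using (ℕ; zero; suc; _+_; _*_; _≤_; _<_; _<?_; _⊔_; z≤n; s≤s)
open import Data.Nat.ListAction using (sum)
open import Data.Nat.Properties hiding (_≟_)
open import Data.Nat.Tactic.RingSolver using (solve-∀)
open import Algebra.Properties.CommutativeMonoid.Sum +-0-commutativeMonoid
  using (∑-distrib-+; ∑-comm) renaming (sum to ∑)
open import Algebra.Properties.CommutativeSemigroup +-commutativeSemigroup using (interchange; xy∙z≈y∙xz)
open import Data.Bool using (Bool; true; false; T; if_then_else_; _∧_; _∨_; not)
open import Data.Bool.ListAction using (any)
open import Data.Bool.Properties using (T-≡; ∧-conicalˡ; ∧-conicalʳ)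
open import Data.Empty using (⊥; ⊥-elim)
open import Data.Fin using (Fin; toℕ; _≟_) renaming (zero to fzero; suc to fsuc)
open import Data.Fin.Patterns using (0F; 1F; 2F; 3F)
open import Data.List using (List; map; foldr; tabulate; allFin)
open import Data.List.Membership.Propositional using (_∈_; find)
open import Data.List.Membership.Propositional.Properties using (∈-++⁻)
open import Data.List.Properties using (map-tabulate; map-cong)
open import Data.List.Relation.Unary.Any using (here; there)
open import Data.List.Relation.Unary.Any.Properties using (any⁻)
open import Data.Product using (_×_; _,_; ∃; ∃₂)
open import Data.Sum using (_⊎_; inj₁; inj₂; [_,_]′)
open import Function using (_∘_; id)
open import Function.Bundles using (Equivalence)
open import Relation.Binary.PropositionalEquality
open import Relation.Nullary using (¬_; yes; no)
open import Relation.Nullary.Decidable using (dec-true; dec-false; isYes≗does)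

when : Bool → ℕ → ℕ
when b n = if b then n else 0

𝟙 : Bool → ℕ
𝟙 b = when b 1

≡⇒== : ∀ {n} {x y : Fin n} → x ≡ y → (x == y) ≡ true
≡⇒== {x = x} {y} x≡y = trans (isYes≗does (x ≟ y)) (dec-true (x ≟ y) x≡y)

≢⇒==false : ∀ {n} {x y : Fin n} → x ≢ y → (x == y) ≡ false
≢⇒==false {x = x} {y} x≢y = trans (isYes≗does (x ≟ y)) (dec-false (x ≟ y) x≢y)

==-refl : ∀ {n} (x : Fin n) → (x == x) ≡ true
==-refl x = ≡⇒== refl

==⇒≡ : ∀ {n} {x y : Fin n} → (x == y) ≡ true → x ≡ y
==⇒≡ {x = x} {y} x==y with x ≟ y
... | yes x≡y = x≡y

implies⇒not==∨== : ∀ {n m} {x p : Fin n} {y q : Fin m} → (x ≡ p → y ≡ q) → (not (x == p) ∨ (y == q)) ≡ true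
implies⇒not==∨== {x = x} {p} x≡p⇒y≡q with x ≟ p
... | yes x≡p = ≡⇒== (x≡p⇒y≡q x≡p)
... | no _ = refl

implies⊎counterexample : ∀ {n m} (x p : Fin n) (y q : Fin m) → (x ≡ p → y ≡ q) ⊎ (x ≡ p × y ≢ q)
implies⊎counterexample x p y q with x ≟ p | y ≟ q
... | no x≢p | _ = inj₁ (⊥-elim ∘ x≢p)
... | yes _ | yes y≡q = inj₁ (λ _ → y≡q)
... | yes x≡p | no y≢q = inj₂ (x≡p , y≢q)

<ᵇ⇒toℕ< : ∀ {n} {x y : Fin n} → (x <ᵇ y) ≡ true → toℕ x < toℕ y
<ᵇ⇒toℕ< {x = x} {y} x<ᵇy with toℕ x <? toℕ y
... | yes x<y = x<y

-- Finite sums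

total≡∑ : ∀ {n} (f : Fin n → ℕ) → total f ≡ ∑ f
total≡∑ {zero} f = refl
total≡∑ {suc n} f = cong (f fzero +_) (begin
  sum (map f (tabulate fsuc))        ≡⟨ cong sum (map-tabulate fsuc f) ⟩
  sum (tabulate (f ∘ fsuc))          ≡⟨ cong sum (map-tabulate id (f ∘ fsuc)) ⟨
  total (f ∘ fsuc)                   ≡⟨ total≡∑ (f ∘ fsuc) ⟩
  ∑ (f ∘ fsuc)                       ∎)
  where open ≡-Reasoning

total-suc : ∀ {n} (f : Fin (suc n) → ℕ) → total f ≡ f fzero + total (f ∘ fsuc)
total-suc f = trans (total≡∑ f) (cong (f fzero +_) (sym (total≡∑ (f ∘ fsuc))))

total-cong : ∀ {n} {f g : Fin n → ℕ} → (∀ x → f x ≡ g x) → total f ≡ total g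
total-cong {n} f≗g = cong sum (map-cong f≗g (allFin n))

total-+ : ∀ {n} (f g : Fin n → ℕ) → total (λ x → f x + g x) ≡ total f + total g
total-+ f g = begin
  total (λ x → f x + g x)  ≡⟨ total≡∑ (λ x → f x + g x) ⟩
  ∑ (λ x → f x + g x)      ≡⟨ ∑-distrib-+ f g ⟩
  ∑ f + ∑ g                ≡⟨ cong₂ _+_ (total≡∑ f) (total≡∑ g) ⟨
  total f + total g        ∎
  where open ≡-Reasoning

total-comm : ∀ {m n} (f : Fin m → Fin n → ℕ) →
  total (λ x → total (f x)) ≡ total (λ y → total (λ x → f x y))
total-comm f = begin
  total (λ x → total (f x))            ≡⟨ trans (total-cong (λ x → total≡∑ (f x))) (total≡∑ (λ x → ∑ (f x))) ⟩
  ∑ (λ x → ∑ (f x))                    ≡⟨ ∑-comm f ⟩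
  ∑ (λ y → ∑ (λ x → f x y))
    ≡⟨ trans (total-cong (λ y → total≡∑ (λ x → f x y))) (total≡∑ (λ y → ∑ (λ x → f x y))) ⟨
  total (λ y → total (λ x → f x y))    ∎
  where open ≡-Reasoning

total-zero : ∀ n → total {n} (λ _ → 0) ≡ 0
total-zero zero = refl
total-zero (suc n) = trans (total-suc {n} (λ _ → 0)) (total-zero n)

total-mono : ∀ {n} {f g : Fin n → ℕ} → (∀ x → f x ≤ g x) → total f ≤ total g
total-mono {zero} f≤g = z≤n
total-mono {suc n} {f} {g} f≤g rewrite total-suc f | total-suc g =
  +-mono-≤ (f≤g fzero) (total-mono (f≤g ∘ fsuc))

term≤total : ∀ {n} (f : Fin n → ℕ) (i : Fin n) → f i ≤ total f
term≤total f fzero = ≤-trans (m≤m+n (f fzero) _) (≤-reflexive (sym (total-suc f)))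
term≤total f (fsuc i) =
  ≤-trans (term≤total (f ∘ fsuc) i) (≤-trans (m≤n+m _ (f fzero)) (≤-reflexive (sym (total-suc f))))

total-when : ∀ {n} b (f : Fin n → ℕ) → total (λ x → when b (f x)) ≡ when b (total f)
total-when true f = refl
total-when {n} false f = total-zero n

total²-when : ∀ {m n} b (f : Fin m → Fin n → ℕ) →
  total (λ x → total (λ y → when b (f x y))) ≡ when b (total (λ x → total (f x)))
total²-when b f = trans (total-cong (λ x → total-when b (f x))) (total-when b (λ x → total (f x)))

total³-when : ∀ {m n k} b (f : Fin m → Fin n → Fin k → ℕ) →
  total (λ x → total (λ y → total (λ z → when b (f x y z)))) ≡ when b (total (λ x → total (λ y → total (f x y))))
total³-when b f = trans (total-cong (λ x → total²-when b (f x))) (total-when b (λ x → total (λ y → total (f x y))))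

total-at : ∀ {n} (p : Fin n) (f : Fin n → ℕ) → total (λ x → when (x == p) (f x)) ≡ f p
total-at {suc n} fzero f = trans (total-suc (λ x → when (x == fzero) (f x)))
  (trans (cong (f fzero +_) (total-zero n)) (+-identityʳ (f fzero)))
total-at {suc n} (fsuc p) f = trans (total-suc (λ x → when (x == fsuc p) (f x)))
  (trans (total-cong (λ x → cong (λ b → when b (f (fsuc x))) (fsuc-== x p))) (total-at p (f ∘ fsuc)))
  where
  fsuc-== : ∀ {n} (x y : Fin n) → (fsuc x == fsuc y) ≡ (x == y)
  fsuc-== x y with x ≟ y
  ... | yes _ = refl
  ... | no _ = refl

total-when-const : ∀ {n} (p : Fin n → Bool) (N : ℕ) → total (λ x → when (p x) N) ≡ count p * N
total-when-const {zero} p N = refl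
total-when-const {suc n} p N = begin
  total (λ x → when (p x) N)                       ≡⟨ total-suc (λ x → when (p x) N) ⟩
  when (p fzero) N + total (λ x → when (p (fsuc x)) N) ≡⟨ cong (when (p fzero) N +_) (total-when-const (p ∘ fsuc) N) ⟩
  when (p fzero) N + count (p ∘ fsuc) * N          ≡⟨ cong (_+ count (p ∘ fsuc) * N) (when≡𝟙* (p fzero)) ⟩
  𝟙 (p fzero) * N + count (p ∘ fsuc) * N           ≡⟨ *-distribʳ-+ N (𝟙 (p fzero)) (count (p ∘ fsuc)) ⟨
  (𝟙 (p fzero) + count (p ∘ fsuc)) * N             ≡⟨ cong (_* N) (total-suc (λ x → 𝟙 (p x))) ⟨
  count p * N                                      ∎
  where
  open ≡-Reasoning
  when≡𝟙* : ∀ b → when b N ≡ 𝟙 b * N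
  when≡𝟙* true = sym (+-identityʳ N)
  when≡𝟙* false = refl

total-count-product : ∀ {m n} (B : Fin m → Bool) (D : Fin n → Bool) →
  total (λ x → total (λ y → when (B x) (𝟙 (D y)))) ≡ count B * count D
total-count-product B D =
  trans (total-cong (λ x → total-when (B x) (λ y → 𝟙 (D y)))) (total-when-const B (count D))

total-when-≤ : ∀ {n} (p : Fin n → Bool) (g : Fin n → ℕ) (K : ℕ) →
  (∀ x → p x ≡ true → g x ≤ K) → total (λ x → when (p x) (g x)) ≤ count p * K
total-when-≤ p g K g≤K = begin
  total (λ x → when (p x) (g x))  ≤⟨ total-mono termwise ⟩
  total (λ x → when (p x) K)      ≡⟨ total-when-const p K ⟩
  count p * K                     ∎
  where
  open ≤-Reasoning
  termwise : ∀ x → when (p x) (g x) ≤ when (p x) K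
  termwise x with p x in px
  ... | true = g≤K x px
  ... | false = z≤n

-- The sum is at most (count q − 1) K + L; K is moved to the left to avoid truncated subtraction.
total-when-≤-except : ∀ {n} (q : Fin n → Bool) (g : Fin n → ℕ) (p : Fin n) (K L : ℕ) →
  q p ≡ true → g p ≤ L → (∀ x → q x ≡ true → g x ≤ K) →
  total (λ x → when (q x) (g x)) + K ≤ count q * K + L
total-when-≤-except q g p K L qp gp≤L g≤K = begin
  total (λ x → when (q x) (g x)) + K
    ≡⟨ cong (total (λ x → when (q x) (g x)) +_) (total-at p (λ _ → K)) ⟨
  total (λ x → when (q x) (g x)) + total (λ x → when (x == p) K)
    ≡⟨ total-+ (λ x → when (q x) (g x)) (λ x → when (x == p) K) ⟨
  total (λ x → when (q x) (g x) + when (x == p) K)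
    ≤⟨ total-mono termwise ⟩
  total (λ x → when (q x) K + when (x == p) L)
    ≡⟨ total-+ (λ x → when (q x) K) (λ x → when (x == p) L) ⟩
  total (λ x → when (q x) K) + total (λ x → when (x == p) L)
    ≡⟨ cong₂ _+_ (total-when-const q K) (total-at p (λ _ → L)) ⟩
  count q * K + L ∎
  where
  open ≤-Reasoning
  termwise : ∀ x → when (q x) (g x) + when (x == p) K ≤ when (q x) K + when (x == p) L
  termwise x with x == p in x==p
  ... | true rewrite ==⇒≡ x==p | qp = ≤-trans (+-monoˡ-≤ K gp≤L) (≤-reflexive (+-comm L K))
  ... | false with q x in qx
  ... | true = +-monoˡ-≤ 0 (g≤K x qx)
  ... | false = z≤n

total-split-< : ∀ {n} (u : Fin n) (f : Fin n → ℕ) →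
  total (λ w → when (u <ᵇ w) (f w)) + total (λ w → when (w <ᵇ u) (f w)) ≤ total f
total-split-< u f =
  ≤-trans (≤-reflexive (sym (total-+ (λ w → when (u <ᵇ w) (f w)) (λ w → when (w <ᵇ u) (f w)))))
    (total-mono termwise)
  where
  termwise : ∀ w → when (u <ᵇ w) (f w) + when (w <ᵇ u) (f w) ≤ f w
  termwise w with u <ᵇ w in u<w | w <ᵇ u in w<u
  ... | true | true = ⊥-elim (<-asym (<ᵇ⇒toℕ< u<w) (<ᵇ⇒toℕ< w<u))
  ... | true | false = ≤-reflexive (+-identityʳ (f w))
  ... | false | true = ≤-refl
  ... | false | false = z≤n

𝟙≤ : ∀ {n} b → (b ≡ true → 1 ≤ n) → 𝟙 b ≤ n
𝟙≤ true 1≤n = 1≤n refl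
𝟙≤ false _ = z≤n

count-mono : ∀ {n} (p q : Fin n → Bool) → (∀ x → p x ≡ true → q x ≡ true) → count p ≤ count q
count-mono p q p⇒q = total-mono termwise
  where
  termwise : ∀ x → 𝟙 (p x) ≤ 𝟙 (q x)
  termwise x with p x in px
  ... | true rewrite p⇒q x px = ≤-refl
  ... | false = z≤n

count-at-most-one : ∀ {n} (p : Fin n → Bool) (q : Fin n) → count (λ x → p x ∧ (x == q)) ≤ 1
count-at-most-one p q = ≤-trans (total-mono termwise) (≤-reflexive (total-at q (λ _ → 1)))
  where
  termwise : ∀ x → 𝟙 (p x ∧ (x == q)) ≤ 𝟙 (x == q)
  termwise x with p x
  ... | true = ≤-refl
  ... | false = z≤n

count-without : ∀ {n} (p : Fin n → Bool) (q : Fin n) → p q ≡ true →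
  count (λ x → p x ∧ not (x == q)) + 1 ≡ count p
count-without p q pq = begin
  count (λ x → p x ∧ not (x == q)) + 1
    ≡⟨ cong (count (λ x → p x ∧ not (x == q)) +_) (total-at q (λ _ → 1)) ⟨
  count (λ x → p x ∧ not (x == q)) + count (_== q)
    ≡⟨ total-+ (λ x → 𝟙 (p x ∧ not (x == q))) (λ x → 𝟙 (x == q)) ⟨
  total (λ x → 𝟙 (p x ∧ not (x == q)) + 𝟙 (x == q))
    ≡⟨ total-cong termwise ⟩
  count p ∎
  where
  open ≡-Reasoning
  termwise : ∀ x → 𝟙 (p x ∧ not (x == q)) + 𝟙 (x == q) ≡ 𝟙 (p x)
  termwise x with x == q in x==q
  ... | true rewrite ==⇒≡ x==q | pq = refl
  ... | false with p x
  ... | true = refl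
  ... | false = refl

count-without-≤ : ∀ {n} (p : Fin n → Bool) (q : Fin n) (k : ℕ) → p q ≡ true → count p ≤ suc k →
  count (λ x → p x ∧ not (x == q)) ≤ k
count-without-≤ p q k pq p≤1+k = +-cancelʳ-≤ 1 _ k (begin
  count (λ x → p x ∧ not (x == q)) + 1  ≡⟨ count-without p q pq ⟩
  count p                               ≤⟨ p≤1+k ⟩
  suc k                                 ≡⟨ +-comm 1 k ⟩
  k + 1                                 ∎)
  where open ≤-Reasoning

count-disjoint : ∀ {n} (p A B : Fin n → Bool) → (∀ x → A x ≡ true → B x ≡ true → ⊥) →
  count (λ x → p x ∧ A x) + count (λ x → p x ∧ B x) ≤ count p
count-disjoint p A B disjoint =
  ≤-trans (≤-reflexive (sym (total-+ (λ x → 𝟙 (p x ∧ A x)) (λ x → 𝟙 (p x ∧ B x))))) (total-mono termwise)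
  where
  termwise : ∀ x → 𝟙 (p x ∧ A x) + 𝟙 (p x ∧ B x) ≤ 𝟙 (p x)
  termwise x with p x | A x in Ax | B x in Bx
  ... | false | _ | _ = z≤n
  ... | true | true | true = ⊥-elim (disjoint x Ax Bx)
  ... | true | true | false = ≤-refl
  ... | true | false | true = ≤-refl
  ... | true | false | false = z≤n

degree≤maxDegree : ∀ {n} (G : SimpleGraph n) (u : Fin n) → degree G u ≤ maxDegree G
degree≤maxDegree {n} G u = subst (degree G u ≤_) (cong (foldr _⊔_ 0) (sym (map-tabulate id (degree G))))
  (≤-foldr-⊔ (degree G) u)
  where
  ≤-foldr-⊔ : ∀ {n} (f : Fin n → ℕ) (x : Fin n) → f x ≤ foldr _⊔_ 0 (tabulate f)
  ≤-foldr-⊔ f fzero = m≤m⊔n _ _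
  ≤-foldr-⊔ f (fsuc x) = ≤-trans (≤-foldr-⊔ (f ∘ fsuc) x) (m≤n⊔m (f fzero) _)

degreeAbove degreeBelow : ∀ {n} → SimpleGraph n → Fin n → ℕ
degreeAbove G u = count (λ w → adj G u w ∧ (u <ᵇ w))
degreeBelow G u = count (λ w → adj G u w ∧ (w <ᵇ u))

degreeAbove+degreeBelow≤maxDegree : ∀ {n} (G : SimpleGraph n) (u : Fin n) →
  degreeAbove G u + degreeBelow G u ≤ maxDegree G
degreeAbove+degreeBelow≤maxDegree G u = ≤-trans
  (count-disjoint (adj G u) (u <ᵇ_) (_<ᵇ u) (λ w u<w w<u → <-asym (<ᵇ⇒toℕ< u<w) (<ᵇ⇒toℕ< w<u)))
  (degree≤maxDegree G u)

-- Clashing similarity edges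

Clash : ∀ {n₁ n₂} → SimEdge n₁ n₂ → SimEdge n₁ n₂ → Set
Clash (u , v) (u' , v') = (u ≡ u' × v ≢ v') ⊎ (u ≢ u' × v ≡ v')

clash⇒Clash : ∀ {n₁ n₂} (e f : SimEdge n₁ n₂) → T (clash e f) → Clash e f
clash⇒Clash (u , v) (u' , v') clash-uv with u ≟ u' | v ≟ v'
... | yes u≡u' | no v≢v' = inj₁ (u≡u' , v≢v')
... | no u≢u' | yes v≡v' = inj₂ (u≢u' , v≡v')

Clash-sym : ∀ {n₁ n₂} {e f : SimEdge n₁ n₂} → Clash e f → Clash f e
Clash-sym (inj₁ (u≡u' , v≢v')) = inj₁ (sym u≡u' , v≢v' ∘ sym)
Clash-sym (inj₂ (u≢u' , v≡v')) = inj₂ (u≢u' ∘ sym , sym v≡v')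

Clash-irrefl : ∀ {n₁ n₂} {e : SimEdge n₁ n₂} → ¬ Clash e e
Clash-irrefl (inj₁ (_ , v≢v)) = v≢v refl
Clash-irrefl (inj₂ (u≢u , _)) = u≢u refl

disjoint⇒¬Clash : ∀ {n₁ n₂} {u u' : Fin n₁} {v v' : Fin n₂} → u ≢ u' → v ≢ v' → ¬ Clash (u , v) (u' , v')
disjoint⇒¬Clash u≢u' v≢v' (inj₁ (u≡u' , _)) = u≢u' u≡u'
disjoint⇒¬Clash u≢u' v≢v' (inj₂ (_ , v≡v')) = v≢v' v≡v'

simEdges-matching : ∀ {n₁ n₂} {a b : Fin n₁} {c d : Fin n₂} → a ≢ b → c ≢ d →
  ∀ {e f} → e ∈ simEdges (a , b , c , d) → f ∈ simEdges (a , b , c , d) → ¬ Clash e f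
simEdges-matching a≢b c≢d (here refl) (here refl) = Clash-irrefl
simEdges-matching a≢b c≢d (there (here refl)) (there (here refl)) = Clash-irrefl
simEdges-matching a≢b c≢d (here refl) (there (here refl)) = disjoint⇒¬Clash a≢b (c≢d ∘ sym)
simEdges-matching a≢b c≢d (there (here refl)) (here refl) = disjoint⇒¬Clash (a≢b ∘ sym) c≢d

notMatching⇒Clash : ∀ {n₁ n₂} (es : List (SimEdge n₁ n₂)) → notMatching es ≡ true →
  ∃₂ λ e f → e ∈ es × f ∈ es × Clash e f
notMatching⇒Clash es bad
  with e , e∈es , e-bad ← find (any⁻ (λ e → any (clash e) es) es (Equivalence.from T-≡ bad))
  with f , f∈es , ef ← find (any⁻ (clash e) es e-bad)
  = e , f , e∈es , f∈es , clash⇒Clash e f ef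

conflict⇒crossClash : ∀ {n₁ n₂} {a b a' b' : Fin n₁} {c d c' d' : Fin n₂} →
  a ≢ b → c ≢ d → a' ≢ b' → c' ≢ d' → conflict (a , b , c , d) (a' , b' , c' , d') ≡ true →
  ∃₂ λ e f → e ∈ simEdges (a , b , c , d) × f ∈ simEdges (a' , b' , c' , d') × Clash e f
conflict⇒crossClash {a = a} {b} {a'} {b'} {c} {d} {c'} {d'} a≢b c≢d a'≢b' c'≢d' conflicting
  with e , f , e∈ , f∈ , clash ← notMatching⇒Clash _ conflicting
  with ∈-++⁻ (simEdges (a , b , c , d)) e∈ | ∈-++⁻ (simEdges (a , b , c , d)) f∈
... | inj₁ e∈x | inj₁ f∈x = ⊥-elim (simEdges-matching a≢b c≢d e∈x f∈x clash)
... | inj₁ e∈x | inj₂ f∈y = e , f , e∈x , f∈y , clash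
... | inj₂ e∈y | inj₁ f∈x = f , e , f∈x , e∈y , Clash-sym clash
... | inj₂ e∈y | inj₂ f∈y = ⊥-elim (simEdges-matching a'≢b' c'≢d' e∈y f∈y clash)

-- Counting the c4s in conflict with a fixed c4

module _ {n₁ n₂ : ℕ} (G₁ : SimpleGraph n₁) (G₂ : SimpleGraph n₂) (S : Bipartite n₁ n₂) where

  record IsC4Vertex (a b : Fin n₁) (c d : Fin n₂) : Set where
    field
      ab∈E₁ : adj G₁ a b ≡ true
      cd∈E₂ : adj G₂ c d ≡ true
      ad∈S  : S a d ≡ true
      bc∈S  : S b c ≡ true
      a<b   : (a <ᵇ b) ≡ true

    a≢b : a ≢ b
    a≢b a≡b = <-irrefl (cong toℕ a≡b) (<ᵇ⇒toℕ< a<b)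

    c≢d : c ≢ d
    c≢d refl with trans (sym cd∈E₂) (irrefl G₂ c)
    ... | ()

  open IsC4Vertex

  isC4vertex⇒IsC4Vertex : ∀ {a b c d} → isC4vertex G₁ G₂ S (a , b , c , d) ≡ true → IsC4Vertex a b c d
  isC4vertex⇒IsC4Vertex {a} {b} {c} {d} h = record
    { ab∈E₁ = ∧-conicalˡ _ _ c4
    ; cd∈E₂ = ∧-conicalˡ _ _ rest₁
    ; ad∈S  = ∧-conicalˡ _ _ rest₂
    ; bc∈S  = ∧-conicalʳ _ _ rest₂
    ; a<b   = ∧-conicalʳ _ _ h
    }
    where
    c4 = ∧-conicalˡ _ _ h
    rest₁ = ∧-conicalʳ (adj G₁ a b) _ c4
    rest₂ = ∧-conicalʳ (adj G₂ c d) _ rest₁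

  Weight : Set
  Weight = Fin n₁ → Fin n₁ → Fin n₂ → Fin n₂ → ℕ

  Σ₄ : Weight → ℕ
  Σ₄ F = total λ a' → total λ b' → total λ c' → total λ d' → F a' b' c' d'

  -- The conflicting c4s y = (a', b', c', d') sharing the vertex u of an edge uv of x:
  -- viaA u v counts those with a' = u, d' ≠ v, viaB u v D those with b' = u, c' ≠ v, D a' d';
  -- viaD v u Z those with d' = v, a' ≠ u and viaC v u Z those with c' = v, b' ≠ u, where Z
  -- restricts the remaining edge of y. The nested guards let Σ₄ be summed one vertex at a time.
  viaA : Fin n₁ → Fin n₂ → Weight
  viaA u v a' b' c' d' = when (a' == u) (when (adj G₁ u b' ∧ (u <ᵇ b')) (when (S b' c') (𝟙 (S u d' ∧ not (d' == v)))))

  viaA-pos : ∀ {u v b' c' d'} → IsC4Vertex u b' c' d' → d' ≢ v → 1 ≤ viaA u v u b' c' d'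
  viaA-pos {u} Y d'≢v rewrite ==-refl u | ab∈E₁ Y | a<b Y | bc∈S Y
    | ad∈S Y | ≢⇒==false d'≢v = ≤-refl

  viaB : Fin n₁ → Fin n₂ → (Fin n₁ → Fin n₂ → Bool) → Weight
  viaB u v D a' b' c' d' = when (b' == u) (when (adj G₁ u a' ∧ (a' <ᵇ u)) (when (S u c' ∧ not (c' == v)) (𝟙 (D a' d'))))

  viaB-pos : ∀ {u v D a' c' d'} → IsC4Vertex a' u c' d' → c' ≢ v → D a' d' ≡ true → 1 ≤ viaB u v D a' u c' d'
  viaB-pos {u} {a' = a'} Y c'≢v Da'd' rewrite ==-refl u | SimpleGraph.sym G₁ u a' | ab∈E₁ Y
    | a<b Y | bc∈S Y | ≢⇒==false c'≢v | Da'd' = ≤-refl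

  viaD : Fin n₂ → Fin n₁ → (Fin n₁ → Fin n₂ → Bool) → Weight
  viaD v u Z a' b' c' d' = when (S a' v ∧ not (a' == u)) (when (a' <ᵇ b') (when (Z b' c') (𝟙 (d' == v))))

  viaD-pos : ∀ {v u Z a' b' c'} → IsC4Vertex a' b' c' v → a' ≢ u → Z b' c' ≡ true → 1 ≤ viaD v u Z a' b' c' v
  viaD-pos {v} Y a'≢u Zb'c' rewrite ad∈S Y | ≢⇒==false a'≢u | a<b Y | Zb'c'
    | ==-refl v = ≤-refl

  viaC : Fin n₂ → Fin n₁ → (Fin n₁ → Fin n₂ → Bool) → Weight
  viaC v u Z a' b' c' d' = when (a' <ᵇ b') (when (S b' v ∧ not (b' == u)) (when (c' == v) (𝟙 (Z a' d'))))

  viaC-pos : ∀ {v u Z a' b' d'} → IsC4Vertex a' b' v d' → b' ≢ u → Z a' d' ≡ true → 1 ≤ viaC v u Z a' b' v d'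
  viaC-pos {v} Y b'≢u Za'd' rewrite a<b Y | bc∈S Y | ≢⇒==false b'≢u | ==-refl v
    | Za'd' = ≤-refl

  Σ₄-viaA : ∀ u v → Σ₄ (viaA u v) ≡
    total (λ b' → when (adj G₁ u b' ∧ (u <ᵇ b')) (count (S b') * count (λ d' → S u d' ∧ not (d' == v))))
  Σ₄-viaA u v = begin
    Σ₄ (viaA u v)
      ≡⟨ total-cong (λ a' → total³-when (a' == u) F) ⟩
    total (λ a' → when (a' == u) (total λ b' → total λ c' → total (F b' c')))
      ≡⟨ total-at u (λ _ → total λ b' → total λ c' → total (F b' c')) ⟩
    total (λ b' → total λ c' → total (F b' c'))
      ≡⟨ total-cong (λ b' → total²-when (A b') (λ c' d' → when (S b' c') (𝟙 (D d')))) ⟩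
    total (λ b' → when (A b') (total λ c' → total λ d' → when (S b' c') (𝟙 (D d'))))
      ≡⟨ total-cong (λ b' → cong (when (A b')) (total-count-product (S b') D)) ⟩
    total (λ b' → when (A b') (count (S b') * count D)) ∎
    where
    open ≡-Reasoning
    A : Fin n₁ → Bool
    A b' = adj G₁ u b' ∧ (u <ᵇ b')
    D : Fin n₂ → Bool
    D d' = S u d' ∧ not (d' == v)
    F : Fin n₁ → Fin n₂ → Fin n₂ → ℕ
    F b' c' d' = when (A b') (when (S b' c') (𝟙 (D d')))

  Σ₄-viaB : ∀ u v D → Σ₄ (viaB u v D) ≡
    total (λ a' → when (adj G₁ u a' ∧ (a' <ᵇ u)) (count (λ c' → S u c' ∧ not (c' == v)) * count (D a')))
  Σ₄-viaB u v D = total-cong λ a' → begin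
    total (λ b' → total λ c' → total (F a' b' c'))
      ≡⟨ total-cong (λ b' → total²-when (b' == u) (G a')) ⟩
    total (λ b' → when (b' == u) (total λ c' → total (G a' c')))
      ≡⟨ total-at u (λ _ → total λ c' → total (G a' c')) ⟩
    total (λ c' → total (G a' c'))
      ≡⟨ total²-when (A a') (λ c' d' → when (B c') (𝟙 (D a' d'))) ⟩
    when (A a') (total λ c' → total λ d' → when (B c') (𝟙 (D a' d')))
      ≡⟨ cong (when (A a')) (total-count-product B (D a')) ⟩
    when (A a') (count B * count (D a')) ∎
    where
    open ≡-Reasoning
    A : Fin n₁ → Bool
    A a' = adj G₁ u a' ∧ (a' <ᵇ u)
    B : Fin n₂ → Bool
    B c' = S u c' ∧ not (c' == v)
    G : Fin n₁ → Fin n₂ → Fin n₂ → ℕ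
    G a' c' d' = when (A a') (when (B c') (𝟙 (D a' d')))
    F : Fin n₁ → Fin n₁ → Fin n₂ → Fin n₂ → ℕ
    F a' b' c' d' = when (b' == u) (G a' c' d')

  Σ₄-viaD : ∀ v u Z → Σ₄ (viaD v u Z) ≡
    total (λ a' → when (S a' v ∧ not (a' == u)) (total (λ w → when (a' <ᵇ w) (count (Z w)))))
  Σ₄-viaD v u Z = total-cong λ a' → begin
    total (λ b' → total λ c' → total λ d' → when (P a') (F a' b' c' d'))
      ≡⟨ total³-when (P a') (F a') ⟩
    when (P a') (total λ b' → total λ c' → total (F a' b' c'))
      ≡⟨ cong (when (P a')) (total-cong λ b' → total²-when (a' <ᵇ b') (H b')) ⟩
    when (P a') (total λ b' → when (a' <ᵇ b') (total λ c' → total (H b' c')))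
      ≡⟨ cong (when (P a')) (total-cong λ b' → cong (when (a' <ᵇ b')) (total-cong λ c' → collapse b' c')) ⟩
    when (P a') (total λ b' → when (a' <ᵇ b') (count (Z b'))) ∎
    where
    open ≡-Reasoning
    P : Fin n₁ → Bool
    P a' = S a' v ∧ not (a' == u)
    H : Fin n₁ → Fin n₂ → Fin n₂ → ℕ
    H b' c' d' = when (Z b' c') (𝟙 (d' == v))
    F : Fin n₁ → Fin n₁ → Fin n₂ → Fin n₂ → ℕ
    F a' b' c' d' = when (a' <ᵇ b') (H b' c' d')
    collapse : ∀ b' c' → total (H b' c') ≡ 𝟙 (Z b' c')
    collapse b' c' = trans (total-when (Z b' c') (λ d' → 𝟙 (d' == v))) (cong (when (Z b' c')) (total-at v (λ _ → 1)))

  Σ₄-viaC : ∀ v u Z → Σ₄ (viaC v u Z) ≡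
    total (λ b' → when (S b' v ∧ not (b' == u)) (total (λ w → when (w <ᵇ b') (count (Z w)))))
  Σ₄-viaC v u Z = begin
    Σ₄ (viaC v u Z)
      ≡⟨ total-cong (λ a' → total-cong λ b' → collapse a' b') ⟩
    total (λ a' → total λ b' → when (a' <ᵇ b') (when (P b') (count (Z a'))))
      ≡⟨ total-comm (λ a' b' → when (a' <ᵇ b') (when (P b') (count (Z a')))) ⟩
    total (λ b' → total λ a' → when (a' <ᵇ b') (when (P b') (count (Z a'))))
      ≡⟨ total-cong (λ b' → trans (total-cong λ a' → when-comm (a' <ᵇ b') (P b') (count (Z a')))
                                   (total-when (P b') (λ a' → when (a' <ᵇ b') (count (Z a'))))) ⟩
    total (λ b' → when (P b') (total λ a' → when (a' <ᵇ b') (count (Z a')))) ∎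
    where
    open ≡-Reasoning
    P : Fin n₁ → Bool
    P b' = S b' v ∧ not (b' == u)
    when-comm : ∀ x y n → when x (when y n) ≡ when y (when x n)
    when-comm true y n = refl
    when-comm false true n = refl
    when-comm false false n = refl
    collapse : ∀ a' b' → total (λ c' → total (viaC v u Z a' b' c')) ≡ when (a' <ᵇ b') (when (P b') (count (Z a')))
    collapse a' b' = begin
      total (λ c' → total λ d' → when (a' <ᵇ b') (when (P b') (when (c' == v) (𝟙 (Z a' d')))))
        ≡⟨ total²-when (a' <ᵇ b') (λ c' d' → when (P b') (when (c' == v) (𝟙 (Z a' d')))) ⟩
      when (a' <ᵇ b') (total λ c' → total λ d' → when (P b') (when (c' == v) (𝟙 (Z a' d'))))
        ≡⟨ cong (when (a' <ᵇ b')) (total²-when (P b') (λ c' d' → when (c' == v) (𝟙 (Z a' d')))) ⟩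
      when (a' <ᵇ b') (when (P b') (total λ c' → total λ d' → when (c' == v) (𝟙 (Z a' d'))))
        ≡⟨ cong (λ t → when (a' <ᵇ b') (when (P b') t))
             (trans (total-cong λ c' → total-when (c' == v) (λ d' → 𝟙 (Z a' d'))) (total-at v (λ _ → count (Z a')))) ⟩
      when (a' <ᵇ b') (when (P b') (count (Z a'))) ∎

  Σ₄-viaD+viaC≤ : ∀ v u Z → Σ₄ (viaD v u Z) + Σ₄ (viaC v u Z) ≤
    count (λ w → S w v ∧ not (w == u)) * total (λ w → count (Z w))
  Σ₄-viaD+viaC≤ v u Z = begin
    Σ₄ (viaD v u Z) + Σ₄ (viaC v u Z)
      ≡⟨ cong₂ _+_ (Σ₄-viaD v u Z) (Σ₄-viaC v u Z) ⟩
    total (λ w → when (P w) (above w)) + total (λ w → when (P w) (below w))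
      ≡⟨ total-+ (λ w → when (P w) (above w)) (λ w → when (P w) (below w)) ⟨
    total (λ w → when (P w) (above w) + when (P w) (below w))
      ≤⟨ total-mono termwise ⟩
    total (λ w → when (P w) (total (λ w → count (Z w))))
      ≡⟨ total-when-const P (total (λ w → count (Z w))) ⟩
    count P * total (λ w → count (Z w)) ∎
    where
    open ≤-Reasoning
    P : Fin n₁ → Bool
    P w = S w v ∧ not (w == u)
    above below : Fin n₁ → ℕ
    above w = total (λ w' → when (w <ᵇ w') (count (Z w')))
    below w = total (λ w' → when (w' <ᵇ w) (count (Z w')))
    termwise : ∀ w → when (P w) (above w) + when (P w) (below w) ≤ when (P w) (total (λ w → count (Z w)))
    termwise w with P w
    ... | true = total-split-< w (λ w' → count (Z w'))
    ... | false = z≤n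

  Σ₄-mono : {F G : Weight} → (∀ a' b' c' d' → F a' b' c' d' ≤ G a' b' c' d') → Σ₄ F ≤ Σ₄ G
  Σ₄-mono F≤G = total-mono λ a' → total-mono λ b' → total-mono λ c' → total-mono λ d' → F≤G a' b' c' d'

  Σ₄-+ : (F G : Weight) → Σ₄ (λ a' b' c' d' → F a' b' c' d' + G a' b' c' d') ≡ Σ₄ F + Σ₄ G
  Σ₄-+ F G = trans
    (total-cong λ a' → trans (total-cong λ b' → trans (total-cong λ c' → total-+ (F a' b' c') (G a' b' c'))
                                                      (total-+ (λ c' → total (F a' b' c')) (λ c' → total (G a' b' c'))))
                             (total-+ (λ b' → total λ c' → total (F a' b' c')) (λ b' → total λ c' → total (G a' b' c'))))
    (total-+ (λ a' → total λ b' → total λ c' → total (F a' b' c')) (λ a' → total λ b' → total λ c' → total (G a' b' c')))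

  Σ₄-total : ∀ {n} (F : Fin n → Weight) →
    Σ₄ (λ a' b' c' d' → total (λ i → F i a' b' c' d')) ≡ total (λ i → Σ₄ (F i))
  Σ₄-total F = trans
    (total-cong λ a' → trans (total-cong λ b' → trans (total-cong λ c' → total-comm (λ d' i → F i a' b' c' d'))
                                                      (total-comm (λ c' i → total (F i a' b' c'))))
                             (total-comm (λ b' i → total λ c' → total (F i a' b' c'))))
    (total-comm (λ a' i → total λ b' → total λ c' → total (F i a' b' c')))

  module ConflictClasses (a b : Fin n₁) (c d : Fin n₂) where

    -- D₄ and Zc leave out the c4s already counted by viaA a d and viaD d a.
    D₄ Zd Zc : Fin n₁ → Fin n₂ → Bool
    D₄ a' d' = S a' d' ∧ (not (a' == a) ∨ (d' == d))
    Zd w z = adj G₂ d z ∧ S w z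
    Zc w z = adj G₂ c z ∧ (S w z ∧ (not (z == d) ∨ (w == a)))

    class₁ class₂ : Fin 4 → Weight
    class₁ 0F = viaA a d
    class₁ 1F = viaB a d S
    class₁ 2F = viaA b c
    class₁ 3F = viaB b c D₄
    class₂ 0F = viaD d a Zd
    class₂ 1F = viaC d a Zd
    class₂ 2F = viaD c b Zc
    class₂ 3F = viaC c b Zc

    Zd-∈ : ∀ {a' b' c'} → IsC4Vertex a' b' c' d → Zd b' c' ≡ true
    Zd-∈ {c' = c'} Y = cong₂ _∧_ (trans (SimpleGraph.sym G₂ d c') (cd∈E₂ Y)) (bc∈S Y)

    Covered : Fin n₁ → Fin n₁ → Fin n₂ → Fin n₂ → Set
    Covered a' b' c' d' = (∃ λ i → 1 ≤ class₁ i a' b' c' d') ⊎ (∃ λ i → 1 ≤ class₂ i a' b' c' d')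

    -- Here cong₂ _∧_ p q : x ∧ y ≡ true ∧ true serves as ∧-introduction.
    conflict⇒Covered : ∀ {a' b' c' d'} → IsC4Vertex a b c d → IsC4Vertex a' b' c' d' →
      conflict (a , b , c , d) (a' , b' , c' , d') ≡ true → Covered a' b' c' d'
    conflict⇒Covered {a'} {b'} {c'} {d'} X Y conflicting
      with conflict⇒crossClash (a≢b X) (c≢d X) (a≢b Y) (c≢d Y) conflicting
    ... | _ , _ , here refl , here refl , inj₁ (refl , d≢d') = inj₁ (0F , viaA-pos Y (d≢d' ∘ sym))
    ... | _ , _ , here refl , here refl , inj₂ (a≢a' , refl) = inj₂ (0F , viaD-pos {Z = Zd} Y (a≢a' ∘ sym) (Zd-∈ Y))
    ... | _ , _ , here refl , there (here refl) , inj₁ (refl , d≢c') = inj₁ (1F , viaB-pos {D = S} Y (d≢c' ∘ sym) (ad∈S Y))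
    ... | _ , _ , here refl , there (here refl) , inj₂ (a≢b' , refl) =
      inj₂ (1F , viaC-pos {Z = Zd} Y (a≢b' ∘ sym) (cong₂ _∧_ (cd∈E₂ Y) (ad∈S Y)))
    ... | _ , _ , there (here refl) , here refl , inj₁ (refl , c≢d') = inj₁ (2F , viaA-pos Y (c≢d' ∘ sym))
    ... | _ , _ , there (here refl) , here refl , inj₂ (b≢a' , refl) with implies⊎counterexample c' d b' a
    ...   | inj₁ c'≡d⇒b'≡a = inj₂ (2F , viaD-pos {Z = Zc} Y (b≢a' ∘ sym)
              (cong₂ _∧_ (trans (SimpleGraph.sym G₂ c c') (cd∈E₂ Y)) (cong₂ _∧_ (bc∈S Y) (implies⇒not==∨== c'≡d⇒b'≡a))))
    ...   | inj₂ (refl , b'≢a) = inj₂ (1F , viaC-pos {Z = Zd} Y b'≢a (cong₂ _∧_ (cd∈E₂ Y) (ad∈S Y)))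
    conflict⇒Covered {a'} {b'} {c'} {d'} X Y _ | _ , _ , there (here refl) , there (here refl) , inj₁ (refl , c≢c')
      with implies⊎counterexample a' a d' d
    ... | inj₁ a'≡a⇒d'≡d = inj₁ (3F , viaB-pos {D = D₄} Y (c≢c' ∘ sym)
            (cong₂ _∧_ (ad∈S Y) (implies⇒not==∨== a'≡a⇒d'≡d)))
    ... | inj₂ (refl , d'≢d) = inj₁ (0F , viaA-pos Y d'≢d)
    conflict⇒Covered {a'} {b'} {c'} {d'} X Y _ | _ , _ , there (here refl) , there (here refl) , inj₂ (b≢b' , refl)
      with implies⊎counterexample d' d a' a
    ... | inj₁ d'≡d⇒a'≡a = inj₂ (3F , viaC-pos {Z = Zc} Y (b≢b' ∘ sym)
            (cong₂ _∧_ (cd∈E₂ Y) (cong₂ _∧_ (ad∈S Y) (implies⇒not==∨== d'≡d⇒a'≡a))))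
    ... | inj₂ (refl , a'≢a) = inj₂ (0F , viaD-pos {Z = Zd} Y a'≢a (Zd-∈ Y))

    side₁ side₂ : Weight
    side₁ a' b' c' d' = total (λ i → class₁ i a' b' c' d')
    side₂ a' b' c' d' = total (λ i → class₂ i a' b' c' d')

    conflictDegree≤ : IsC4Vertex a b c d →
      conflictDegree G₁ G₂ S (a , b , c , d) ≤ total (λ i → Σ₄ (class₁ i)) + total (λ i → Σ₄ (class₂ i))
    conflictDegree≤ X = begin
      conflictDegree G₁ G₂ S (a , b , c , d)                         ≤⟨ Σ₄-mono termwise ⟩
      Σ₄ (λ a' b' c' d' → side₁ a' b' c' d' + side₂ a' b' c' d')      ≡⟨ Σ₄-+ side₁ side₂ ⟩
      Σ₄ side₁ + Σ₄ side₂                                            ≡⟨ cong₂ _+_ (Σ₄-total class₁) (Σ₄-total class₂) ⟩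
      total (λ i → Σ₄ (class₁ i)) + total (λ i → Σ₄ (class₂ i))     ∎
      where
      open ≤-Reasoning
      termwise : ∀ a' b' c' d' →
        𝟙 (isC4vertex G₁ G₂ S (a' , b' , c' , d') ∧ not (quadEq (a , b , c , d) (a' , b' , c' , d'))
           ∧ conflict (a , b , c , d) (a' , b' , c' , d'))
        ≤ side₁ a' b' c' d' + side₂ a' b' c' d'
      termwise a' b' c' d' = 𝟙≤ _ λ counted →
        [ in₁ , in₂ ]′ (conflict⇒Covered X (isC4vertex⇒IsC4Vertex (∧-conicalˡ _ _ counted))
                          (∧-conicalʳ _ _ (∧-conicalʳ (isC4vertex G₁ G₂ S (a' , b' , c' , d')) _ counted)))
        where
        in₁ : ∃ (λ i → 1 ≤ class₁ i a' b' c' d') → 1 ≤ side₁ a' b' c' d' + side₂ a' b' c' d'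
        in₁ (i , 1≤) = ≤-trans 1≤ (≤-trans (term≤total (λ i → class₁ i a' b' c' d') i)
                                           (m≤m+n (side₁ a' b' c' d') (side₂ a' b' c' d')))
        in₂ : ∃ (λ i → 1 ≤ class₂ i a' b' c' d') → 1 ≤ side₁ a' b' c' d' + side₂ a' b' c' d'
        in₂ (i , 1≤) = ≤-trans 1≤ (≤-trans (term≤total (λ i → class₂ i a' b' c' d') i)
                                           (m≤n+m (side₂ a' b' c' d') (side₁ a' b' c' d')))

  module _ (k₁ k₂ : ℕ) (degS₁≤ : ∀ u → degS₁ S u ≤ suc k₁) (degS₂≤ : ∀ v → degS₂ S v ≤ suc k₂) where

    Σ₄-viaA≤ : ∀ u v → S u v ≡ true → Σ₄ (viaA u v) ≤ degreeAbove G₁ u * (suc k₁ * k₁)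
    Σ₄-viaA≤ u v uv∈S = ≤-trans (≤-reflexive (Σ₄-viaA u v)) (total-when-≤ _ _ (suc k₁ * k₁)
      (λ b' _ → *-mono-≤ (degS₁≤ b') (count-without-≤ (S u) v k₁ uv∈S (degS₁≤ u))))

    Σ₄-viaB≤ : ∀ u v D → (∀ a' d' → D a' d' ≡ true → S a' d' ≡ true) → S u v ≡ true →
      Σ₄ (viaB u v D) ≤ degreeBelow G₁ u * (suc k₁ * k₁)
    Σ₄-viaB≤ u v D D⊆S uv∈S = ≤-trans (≤-reflexive (Σ₄-viaB u v D)) (total-when-≤ _ _ (suc k₁ * k₁)
      (λ a' _ → ≤-trans (*-mono-≤ (count-without-≤ (S u) v k₁ uv∈S (degS₁≤ u))
                                  (≤-trans (count-mono (D a') (S a') (D⊆S a')) (degS₁≤ a')))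
                        (≤-reflexive (*-comm k₁ (suc k₁)))))

    Σ₄-viaB≤-except : ∀ u v D p → (∀ a' d' → D a' d' ≡ true → S a' d' ≡ true) → S u v ≡ true →
      (adj G₁ u p ∧ (p <ᵇ u)) ≡ true → count (D p) ≤ 1 →
      Σ₄ (viaB u v D) + suc k₁ * k₁ ≤ degreeBelow G₁ u * (suc k₁ * k₁) + k₁
    Σ₄-viaB≤-except u v D p D⊆S uv∈S p∈N Dp≤1 =
      ≤-trans (+-monoˡ-≤ (suc k₁ * k₁) (≤-reflexive (Σ₄-viaB u v D)))
        (total-when-≤-except _ _ p (suc k₁ * k₁) k₁ p∈N
          (≤-trans (*-mono-≤ B≤k₁ Dp≤1) (≤-reflexive (*-identityʳ k₁)))
          (λ a' _ → ≤-trans (*-mono-≤ B≤k₁ (≤-trans (count-mono (D a') (S a') (D⊆S a')) (degS₁≤ a')))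
                            (≤-reflexive (*-comm k₁ (suc k₁)))))
      where
      B≤k₁ : count (λ c' → S u c' ∧ not (c' == v)) ≤ k₁
      B≤k₁ = count-without-≤ (S u) v k₁ uv∈S (degS₁≤ u)

    total-count-adj : ∀ v (R : Fin n₁ → Fin n₂ → Bool) →
      total (λ w → count (λ z → adj G₂ v z ∧ R w z)) ≡ total (λ z → when (adj G₂ v z) (count (λ w → R w z)))
    total-count-adj v R = trans (total-comm (λ w z → 𝟙 (adj G₂ v z ∧ R w z)))
      (total-cong λ z → trans (total-cong λ w → 𝟙-∧ (adj G₂ v z) (R w z)) (total-when (adj G₂ v z) (λ w → 𝟙 (R w z))))
      where
      𝟙-∧ : ∀ x y → 𝟙 (x ∧ y) ≡ when x (𝟙 y)
      𝟙-∧ true y = refl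
      𝟙-∧ false y = refl

    total-count-adj≤ : ∀ v (R : Fin n₁ → Fin n₂ → Bool) → (∀ w z → R w z ≡ true → S w z ≡ true) →
      total (λ w → count (λ z → adj G₂ v z ∧ R w z)) ≤ maxDegree G₂ * suc k₂
    total-count-adj≤ v R R⊆S = ≤-trans (≤-reflexive (total-count-adj v R))
      (≤-trans (total-when-≤ (adj G₂ v) _ (suc k₂) (λ z _ → ≤-trans (count-mono _ _ (λ w → R⊆S w z)) (degS₂≤ z)))
        (*-monoˡ-≤ (suc k₂) (degree≤maxDegree G₂ v)))

    total-count-adj≤-except : ∀ v (R : Fin n₁ → Fin n₂ → Bool) z₀ → (∀ w z → R w z ≡ true → S w z ≡ true) →
      adj G₂ v z₀ ≡ true → count (λ w → R w z₀) ≤ 1 →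
      total (λ w → count (λ z → adj G₂ v z ∧ R w z)) + suc k₂ ≤ maxDegree G₂ * suc k₂ + 1
    total-count-adj≤-except v R z₀ R⊆S z₀∈N Rz₀≤1 =
      ≤-trans (+-monoˡ-≤ (suc k₂) (≤-reflexive (total-count-adj v R)))
        (≤-trans (total-when-≤-except (adj G₂ v) _ z₀ (suc k₂) 1 z₀∈N Rz₀≤1
                   (λ z _ → ≤-trans (count-mono _ _ (λ w → R⊆S w z)) (degS₂≤ z)))
          (+-monoˡ-≤ 1 (*-monoˡ-≤ (suc k₂) (degree≤maxDegree G₂ v))))

    module _ {a b : Fin n₁} {c d : Fin n₂} (X : IsC4Vertex a b c d) where
      open ConflictClasses a b c d

      side₁-bound : total (λ i → Σ₄ (class₁ i)) + k₁ * k₁ ≤ (maxDegree G₁ + maxDegree G₁) * (suc k₁ * k₁)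
      side₁-bound = begin
        A₁ + (A₂ + (A₃ + (A₄ + 0))) + k₁ * k₁  ≡⟨ regroup A₁ A₂ A₃ A₄ (k₁ * k₁) ⟩
        (A₁ + A₂) + (A₃ + (A₄ + k₁ * k₁))      ≤⟨ +-mono-≤ (+-mono-≤ A₁≤ A₂≤) (+-mono-≤ A₃≤ A₄≤) ⟩
        (degreeAbove G₁ a * K + degreeBelow G₁ a * K) + (degreeAbove G₁ b * K + degreeBelow G₁ b * K)
                                               ≤⟨ +-mono-≤ (at a) (at b) ⟩
        Δ₁ * K + Δ₁ * K                        ≡⟨ *-distribʳ-+ K Δ₁ Δ₁ ⟨
        (Δ₁ + Δ₁) * K                          ∎
        where
        open ≤-Reasoning
        Δ₁ = maxDegree G₁
        K = suc k₁ * k₁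
        A₁ = Σ₄ (viaA a d)
        A₂ = Σ₄ (viaB a d S)
        A₃ = Σ₄ (viaA b c)
        A₄ = Σ₄ (viaB b c D₄)
        regroup : ∀ x₁ x₂ x₃ x₄ y → x₁ + (x₂ + (x₃ + (x₄ + 0))) + y ≡ (x₁ + x₂) + (x₃ + (x₄ + y))
        regroup = solve-∀
        at : ∀ u → degreeAbove G₁ u * K + degreeBelow G₁ u * K ≤ Δ₁ * K
        at u = ≤-trans (≤-reflexive (sym (*-distribʳ-+ K (degreeAbove G₁ u) (degreeBelow G₁ u))))
                       (*-monoˡ-≤ K (degreeAbove+degreeBelow≤maxDegree G₁ u))
        A₁≤ : A₁ ≤ degreeAbove G₁ a * K
        A₁≤ = Σ₄-viaA≤ a d (ad∈S X)
        A₂≤ : A₂ ≤ degreeBelow G₁ a * K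
        A₂≤ = Σ₄-viaB≤ a d S (λ _ _ → id) (ad∈S X)
        A₃≤ : A₃ ≤ degreeAbove G₁ b * K
        A₃≤ = Σ₄-viaA≤ b c (bc∈S X)
        D₄a≤1 : count (D₄ a) ≤ 1
        D₄a≤1 rewrite ==-refl a = count-at-most-one (S a) d
        A₄≤ : A₄ + k₁ * k₁ ≤ degreeBelow G₁ b * K
        A₄≤ = +-cancelʳ-≤ k₁ _ _ (begin
          A₄ + k₁ * k₁ + k₁    ≡⟨ +-assoc A₄ (k₁ * k₁) k₁ ⟩
          A₄ + (k₁ * k₁ + k₁)  ≡⟨ cong (A₄ +_) (+-comm (k₁ * k₁) k₁) ⟩
          A₄ + K               ≤⟨ Σ₄-viaB≤-except b c D₄ a (λ _ _ → ∧-conicalˡ _ _) (bc∈S X)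
                                    (cong₂ _∧_ (trans (SimpleGraph.sym G₁ b a) (ab∈E₁ X)) (a<b X)) D₄a≤1 ⟩
          degreeBelow G₁ b * K + k₁ ∎)

      side₂-bound : total (λ i → Σ₄ (class₂ i)) + k₂ * k₂ ≤ (maxDegree G₂ + maxDegree G₂) * (suc k₂ * k₂)
      side₂-bound = +-cancelʳ-≤ k₂ _ _ (begin
        B₁ + (B₂ + (B₃ + (B₄ + 0))) + k₂ * k₂ + k₂  ≡⟨ regroup B₁ B₂ B₃ B₄ k₂ ⟩
        (B₁ + B₂) + ((B₃ + B₄) + k₂ * suc k₂)      ≤⟨ +-mono-≤ B₁₂≤ (+-monoˡ-≤ (k₂ * suc k₂) B₃₄≤) ⟩
        k₂ * (Δ₂ * suc k₂) + (k₂ * Wc + k₂ * suc k₂) ≡⟨ cong (k₂ * (Δ₂ * suc k₂) +_) (*-distribˡ-+ k₂ Wc (suc k₂)) ⟨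
        k₂ * (Δ₂ * suc k₂) + k₂ * (Wc + suc k₂)    ≤⟨ +-monoʳ-≤ (k₂ * (Δ₂ * suc k₂)) (*-monoʳ-≤ k₂ Wc≤) ⟩
        k₂ * (Δ₂ * suc k₂) + k₂ * (Δ₂ * suc k₂ + 1) ≡⟨ collect k₂ Δ₂ ⟩
        (Δ₂ + Δ₂) * (suc k₂ * k₂) + k₂             ∎)
        where
        open ≤-Reasoning
        Δ₂ = maxDegree G₂
        B₁ = Σ₄ (viaD d a Zd)
        B₂ = Σ₄ (viaC d a Zd)
        B₃ = Σ₄ (viaD c b Zc)
        B₄ = Σ₄ (viaC c b Zc)
        Wc = total (λ w → count (Zc w))
        regroup : ∀ x₁ x₂ x₃ x₄ k → x₁ + (x₂ + (x₃ + (x₄ + 0))) + k * k + k ≡ (x₁ + x₂) + ((x₃ + x₄) + k * suc k)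
        regroup = solve-∀
        collect : ∀ k Δ → k * (Δ * suc k) + k * (Δ * suc k + 1) ≡ (Δ + Δ) * (suc k * k) + k
        collect = solve-∀
        B₁₂≤ : B₁ + B₂ ≤ k₂ * (Δ₂ * suc k₂)
        B₁₂≤ = ≤-trans (Σ₄-viaD+viaC≤ d a Zd)
          (*-mono-≤ (count-without-≤ (λ w → S w d) a k₂ (ad∈S X) (degS₂≤ d)) (total-count-adj≤ d S (λ _ _ → id)))
        B₃₄≤ : B₃ + B₄ ≤ k₂ * Wc
        B₃₄≤ = ≤-trans (Σ₄-viaD+viaC≤ c b Zc) (*-monoˡ-≤ Wc (count-without-≤ (λ w → S w c) b k₂ (bc∈S X) (degS₂≤ c)))
        R : Fin n₁ → Fin n₂ → Bool
        R w z = S w z ∧ (not (z == d) ∨ (w == a))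
        Rd≤1 : count (λ w → R w d) ≤ 1
        Rd≤1 rewrite ==-refl d = count-at-most-one (λ w → S w d) a
        Wc≤ : Wc + suc k₂ ≤ Δ₂ * suc k₂ + 1
        Wc≤ = total-count-adj≤-except c R d (λ _ _ → ∧-conicalˡ _ _) (cd∈E₂ X) Rd≤1

-- Opened only here: the constructor +_ would make the sections (x +_) above ambiguous.
open import Data.Integer using (+_) renaming (_≤_ to _≤ℤ_)
import Data.Integer as ℤ
import Data.Integer.Properties as ℤ

m+n≤o⇒+m≤+o-+n : ∀ {m n o} → m + n ≤ o → + m ≤ℤ + o ℤ.- + n
m+n≤o⇒+m≤+o-+n {m} {n} {o} m+n≤o =
  subst (+ m ≤ℤ_) (sym (trans (ℤ.m-n≡m⊖n o n) (ℤ.⊖-≥ (≤-trans (m≤n+m n m) m+n≤o))))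
    (ℤ.+≤+ (m+n≤o⇒m≤o∸n m m+n≤o))

-- With mᵢ = kᵢ + 1, the bound equals 2Δ₁m₁k₁ − k₁² + 2Δ₂m₂k₂ − k₂².
bound-from-sides : ∀ {C V₁ V₂} Δ₁ Δ₂ k₁ k₂ → C ≤ V₁ + V₂ →
  V₁ + k₁ * k₁ ≤ (Δ₁ + Δ₁) * (suc k₁ * k₁) → V₂ + k₂ * k₂ ≤ (Δ₂ + Δ₂) * (suc k₂ * k₂) →
  + C ≤ℤ bound Δ₁ Δ₂ (suc k₁) (suc k₂)
bound-from-sides {C} {V₁} {V₂} Δ₁ Δ₂ k₁ k₂ C≤V₁+V₂ V₁-bound V₂-bound =
  m+n≤o⇒+m≤+o-+n (+-cancelʳ-≤ K (C + Y) X (begin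
    C + Y + K            ≡⟨ xy∙z≈y∙xz C Y K ⟩
    Y + (C + K)          ≤⟨ +-monoʳ-≤ Y (begin
      C + K                            ≤⟨ +-monoˡ-≤ K C≤V₁+V₂ ⟩
      V₁ + V₂ + (k₁ * k₁ + k₂ * k₂)    ≡⟨ interchange V₁ V₂ (k₁ * k₁) (k₂ * k₂) ⟩
      V₁ + k₁ * k₁ + (V₂ + k₂ * k₂)    ≤⟨ +-mono-≤ V₁-bound V₂-bound ⟩
      P                                ∎) ⟩
    Y + P                ≡⟨ expand Δ₁ Δ₂ k₁ k₂ ⟩
    X + K                ∎))
  where
  open ≤-Reasoning
  X Y K P : ℕ
  X = 2 * Δ₁ * suc k₁ * suc k₁ + 2 * Δ₂ * suc k₂ * suc k₂ + 2 * suc k₁ + 2 * suc k₂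
  Y = 2 * Δ₁ * suc k₁ + 2 * Δ₂ * suc k₂ + suc k₁ * suc k₁ + suc k₂ * suc k₂ + 2
  K = k₁ * k₁ + k₂ * k₂
  P = (Δ₁ + Δ₁) * (suc k₁ * k₁) + (Δ₂ + Δ₂) * (suc k₂ * k₂)
  expand : ∀ Δ₁ Δ₂ k₁ k₂ →
    2 * Δ₁ * suc k₁ + 2 * Δ₂ * suc k₂ + suc k₁ * suc k₁ + suc k₂ * suc k₂ + 2
      + ((Δ₁ + Δ₁) * (suc k₁ * k₁) + (Δ₂ + Δ₂) * (suc k₂ * k₂))
    ≡ 2 * Δ₁ * suc k₁ * suc k₁ + 2 * Δ₂ * suc k₂ * suc k₂ + 2 * suc k₁ + 2 * suc k₂ + (k₁ * k₁ + k₂ * k₂)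
  expand = solve-∀

lemma17 : ∀ {n₁ n₂ : ℕ} (G₁ : SimpleGraph n₁) (G₂ : SimpleGraph n₂) (S : Bipartite n₁ n₂)
          (m₁ m₂ : ℕ) → 1 ≤ m₁ → 1 ≤ m₂
          → (∀ u → degS₁ S u ≤ m₁) → (∀ v → degS₂ S v ≤ m₂)
          → (x : Quad n₁ n₂) → isC4vertex G₁ G₂ S x ≡ true
          → + conflictDegree G₁ G₂ S x ≤ℤ bound (maxDegree G₁) (maxDegree G₂) m₁ m₂
lemma17 G₁ G₂ S (suc k₁) (suc k₂) (s≤s z≤n) (s≤s z≤n) degS₁≤ degS₂≤ (a , b , c , d) x∈C =
  bound-from-sides (maxDegree G₁) (maxDegree G₂) k₁ k₂
    (ConflictClasses.conflictDegree≤ G₁ G₂ S a b c d X)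
    (side₁-bound G₁ G₂ S k₁ k₂ degS₁≤ degS₂≤ X)
    (side₂-bound G₁ G₂ S k₁ k₂ degS₁≤ degS₂≤ X)
  where
  X : IsC4Vertex G₁ G₂ S a b c d
  X = isC4vertex⇒IsC4Vertex G₁ G₂ S x∈C
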